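{- Let $n\ge3$ and let $P$ be a convex polygon with $n$ vertices. (i) If $n$ is odd, the number of possible parity sequences of triangulations of $P$ is $\left[\frac{n-1}{2}\right]_{4}$. (ii) If $n=2m$ is even, this number is $\binom{m}{2}_{2}+2^{m-1}-1$.
   Context: For a triangulation of a convex polygon $P_1\cdots P_n$, its quiddity is $(d_1,\ldots,d_n)$ where $d_i$ is the number of triangles having $P_i$ as a vertex; its parity sequence is $(d_1 \bmod 2,\ldots,d_n\bmod 2)\in\mathbb{F}_2^n$. For integers $m\ge1$, $Q>1$: $[m]_{Q}=\frac{Q^{m}-1}{Q-1}$ and $\binom{m}{2}_{Q}=\frac{(Q^{m}-1)(Q^{m-1}-1)}{(Q-1)(Q^{2}-1)}$. -}

module Defs where

open import Data.Nat using (ℕ; zero; suc; _+_; _*_; _∸_; _^_; _<_; _≡ᵇ_; NonZero)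
open import Data.Nat.DivMod using (_/_; _%_)
open import Data.Bool using (Bool; _∨_)
open import Data.Fin using (Fin; toℕ)
open import Data.List using (List; []; _∷_; _++_; length; filterᵇ)
open import Data.Vec using (Vec; tabulate)
open import Data.Product using (_×_; _,_)
open import Relation.Binary.PropositionalEquality using (_≡_)

-- Vertices of the convex polygon P_1 ... P_n are labelled 0 , 1 , ... , n-1
-- (P_{i+1} has label i), in cyclic order.

-- A triangulation of the sub-polygon with consecutive vertices i , i+1 , ... , j
-- (i < j).  If j = i+1 the sub-polygon is a single edge and there is nothing to
-- triangulate.  Otherwise the side (i , j) lies in exactly one triangle (i , k , j)
-- with i < k < j, and the rest is a triangulation of the sub-polygons i..k and k..j.
data Triangulation (i j : ℕ) : Set where
  edge  : j ≡ suc i → Triangulation i j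
  split : (k : ℕ) → i < k → k < j → Triangulation i k → Triangulation k j → Triangulation i j

PolygonTriangulation : ℕ → Set
PolygonTriangulation n = Triangulation 0 (n ∸ 1)

Triangle : Set
Triangle = ℕ × ℕ × ℕ

triangles : ∀ {i j} → Triangulation i j → List Triangle
triangles {i} {j} (edge _) = []
triangles {i} {j} (split k _ _ t₁ t₂) = (i , k , j) ∷ (triangles t₁ ++ triangles t₂)

hasVertex : ℕ → Triangle → Bool
hasVertex v (a , b , c) = (v ≡ᵇ a) ∨ (v ≡ᵇ b) ∨ (v ≡ᵇ c)

quiddityAt : ∀ {i j} → Triangulation i j → ℕ → ℕ
quiddityAt t v = length (filterᵇ (hasVertex v) (triangles t))

quiddity : (n : ℕ) → PolygonTriangulation n → Vec ℕ n
quiddity n t = tabulate (λ (v : Fin n) → quiddityAt t (toℕ v))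

mod2 : ℕ → Fin 2
mod2 zero = Fin.zero
mod2 (suc zero) = Fin.suc Fin.zero
mod2 (suc (suc d)) = mod2 d

paritySequence : (n : ℕ) → PolygonTriangulation n → Vec (Fin 2) n
paritySequence n t = tabulate (λ (v : Fin n) → mod2 (quiddityAt t (toℕ v)))

qInt : (Q m : ℕ) → .{{NonZero (Q ∸ 1)}} → ℕ
qInt Q m = (Q ^ m ∸ 1) / (Q ∸ 1)

qBinom2 : (Q m : ℕ) → .{{NonZero ((Q ∸ 1) * (Q ^ 2 ∸ 1))}} → ℕ
qBinom2 Q m = ((Q ^ m ∸ 1) * (Q ^ (m ∸ 1) ∸ 1)) / ((Q ∸ 1) * (Q ^ 2 ∸ 1))

open import Data.List.Membership.Propositional using (_∈_)
open import Data.List.Relation.Unary.Unique.Propositional using (Unique)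
open import Data.Product using (Σ; ∃)
open import Function.Bundles using (_⇔_)

IsParitySequence : (n : ℕ) → Vec (Fin 2) n → Set
IsParitySequence n s = ∃ λ (t : PolygonTriangulation n) → paritySequence n t ≡ s

-- "the number of possible parity sequences of triangulations of the n-gon is N":
-- the set of such sequences is listed without repetition by a list of length N.
NumParitySequences : (n N : ℕ) → Set
NumParitySequences n N =
  Σ (List (Vec (Fin 2) n)) λ L →
    Unique L × (∀ s → (s ∈ L) ⇔ IsParitySequence n s) × (length L ≡ N)

-- Over 𝔽₂ the frieze matrices M(d) = [[d , 1] , [1 , 0]] generate SL₂(𝔽₂) ≅ S₃, with M(0)
-- of order 2 and M(1) of order 3.  For n ≥ 3 a word s ∈ 𝔽₂ⁿ is the parity sequence of a
-- triangulation iff M(s₁) ⋯ M(sₙ) = 1 and s ≠ 0 (every triangulation has an ear, a vertex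
-- in a single triangle).  Necessity: glue the two parts on either side of the triangle
-- (i , k , j) over the side (i , j).  Sufficiency: build the triangulation of a sub-polygon
-- recursively, choosing the apex k from the first odd letter (or an ear at j), so that both
-- parts again have words with trivial product.  Finally, the number of words of length
-- k + 1 with product g depends only on whether g ∈ {M(0) , M(1)}; the resulting two-term
-- recursion gives [k]₄ words with product 1 for n = 2k + 1 and 2[m − 1]₄ + 1 for n = 2m,
-- of which one is the zero word.

module Submission where

open import Defs
open import Data.Nat using (ℕ; zero; suc; _+_; _*_; _∸_; _^_; _≤_; _<_; _≡ᵇ_; z≤n; s≤s; _<?_; _≤?_)
open import Data.Nat.Properties
open import Data.Nat.DivMod using (_/_; m*n/n≡m; +-distrib-/-∣ʳ)
open import Data.Nat.Divisibility using (n∣m*n)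
open import Data.Nat.Tactic.RingSolver using (solve-∀)
open import Algebra.Properties.CommutativeSemigroup +-commutativeSemigroup using (xy∙z≈xz∙y)
open import Data.Bool using (Bool; true; false)
open import Data.Bool.Properties using (T?)
import Data.Bool.Properties as Bool
open import Data.Fin using (Fin; fromℕ<) renaming (zero to fzero; suc to fsuc)
open import Data.Fin.Properties using (all?; any?; toℕ-fromℕ<) renaming (_≟_ to _≟ᶠ_)
open import Data.Vec using (Vec; []; _∷_; tabulate)
open import Data.Vec.Properties using (∷-injectiveʳ)
open import Data.Vec.Relation.Unary.Any using (here; there)
open import Data.Vec.Membership.DecPropositional (_≟ᶠ_ {2}) using (_∈_; _∈?_)
open import Data.List using (List; []; _∷_; _++_; length; map; filter; filterᵇ)
open import Data.List.Properties using (length-++; filter-++; filter-≐)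
open import Data.List.Relation.Unary.Unique.Propositional using (Unique)
import Data.List.Relation.Unary.Unique.Propositional.Properties as Unique
import Data.List.Relation.Unary.AllPairs as AllPairs
import Data.List.Relation.Unary.All as All
import Data.List.Membership.Propositional as List
open import Data.List.Membership.Propositional.Properties using (∈-map⁺; ∈-map⁻; ∈-++⁺ˡ; ∈-++⁺ʳ; ∈-filter⁺; ∈-filter⁻)
open import Data.List.Relation.Unary.Any using () renaming (here to hereₗ)
open import Data.Product using (Σ; ∃-syntax; _×_; _,_; proj₁; proj₂)
open import Data.Sum using (_⊎_; inj₁; inj₂)
open import Data.Empty using (⊥; ⊥-elim)
open import Function using (_∘_)
open import Function.Bundles using (mk⇔)
open import Relation.Nullary using (¬_; yes; no; does)
open import Relation.Nullary.Decidable using (from-yes; dec-true; dec-false; ¬?; _×-dec_; _→-dec_; _⊎-dec_)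
open import Relation.Unary using (Decidable; _≐_)
open import Relation.Binary.Definitions using (tri<; tri≈; tri>)
open import Relation.Binary.PropositionalEquality using (_≡_; _≢_; ≢-sym; refl; sym; trans; cong; cong₂; subst; module ≡-Reasoning)

pattern even = fzero
pattern odd  = fsuc fzero

infixl 6 _⊕_
_⊕_ : Fin 2 → Fin 2 → Fin 2
even ⊕ y    = y
odd  ⊕ even = odd
odd  ⊕ odd  = even

toggle : Fin 2 → Fin 2
toggle = odd ⊕_

mod2-suc : ∀ d → mod2 (suc d) ≡ toggle (mod2 d)
mod2-suc zero          = refl
mod2-suc (suc zero)    = refl
mod2-suc (suc (suc d)) = mod2-suc d

mod2-+ : ∀ m n → mod2 (m + n) ≡ mod2 m ⊕ mod2 n
mod2-+ zero          n = refl
mod2-+ (suc zero)    n = mod2-suc n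
mod2-+ (suc (suc m)) n = mod2-+ m n

toggle-involutive : ∀ x → toggle (toggle x) ≡ x
toggle-involutive even = refl
toggle-involutive odd  = refl

-- Encoded as Fin 6 so that equality and quantification over the group are decidable.
S₃ : Set
S₃ = Fin 6

pattern e   = fzero
pattern a   = fsuc fzero
pattern b   = fsuc (fsuc fzero)
pattern b²  = fsuc (fsuc (fsuc fzero))
pattern ab  = fsuc (fsuc (fsuc (fsuc fzero)))
pattern ab² = fsuc (fsuc (fsuc (fsuc (fsuc fzero))))

infixl 7 _·_
_·_ : S₃ → S₃ → S₃
e   · g   = g
a   · e   = a
a   · a   = e
a   · b   = ab
a   · b²  = ab²
a   · ab  = b
a   · ab² = b²
b   · e   = b
b   · a   = ab²
b   · b   = b²
b   · b²  = e
b   · ab  = a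
b   · ab² = ab
b²  · e   = b²
b²  · a   = ab
b²  · b   = e
b²  · b²  = b
b²  · ab  = ab²
b²  · ab² = a
ab  · e   = ab
ab  · a   = b²
ab  · b   = ab²
ab  · b²  = a
ab  · ab  = e
ab  · ab² = b
ab² · e   = ab²
ab² · a   = b
ab² · b   = a
ab² · b²  = ab
ab² · ab  = b²
ab² · ab² = e

·-assoc : ∀ x y z → (x · y) · z ≡ x · (y · z)
·-assoc = from-yes (all? λ x → all? λ y → all? λ z → (x · y) · z ≟ᶠ x · (y · z))

·-identityʳ : ∀ x → x · e ≡ x
·-identityʳ = from-yes (all? λ x → x · e ≟ᶠ x)

-- ⟦ d ⟧ is the frieze matrix M(d) = [[d , 1] , [1 , 0]] as an element of SL₂(𝔽₂) ≅ S₃.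
⟦_⟧ : Fin 2 → S₃
⟦ even ⟧ = a
⟦ odd  ⟧ = b

a^_ : ℕ → S₃
a^ zero  = e
a^ suc n = a · a^ n

a^-cases : ∀ n → a^ n ≡ e ⊎ a^ n ≡ a
a^-cases zero = inj₁ refl
a^-cases (suc n) with a^-cases n
... | inj₁ aⁿ≡e rewrite aⁿ≡e = inj₂ refl
... | inj₂ aⁿ≡a rewrite aⁿ≡a = inj₁ refl

a^-double : ∀ n → a^ (n + n) ≡ e
a^-double zero    = refl
a^-double (suc n) rewrite +-suc n n | a^-double n = refl

Agree : ℕ → ℕ → (ℕ → Fin 2) → (ℕ → Fin 2) → Set
Agree i j f g = ∀ w → i ≤ w → w < j → f w ≡ g w

Agree-extend : ∀ {f g i j} → Agree i j f g → (i ≤ j → f j ≡ g j) → Agree i (suc j) f g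
Agree-extend f≐g fj≡gj w i≤w w<1+j with m≤n⇒m<n∨m≡n (≤-pred w<1+j)
... | inj₁ w<j  = f≐g w i≤w w<j
... | inj₂ refl = fj≡gj i≤w

∏ₗ : (ℕ → Fin 2) → ℕ → ℕ → S₃
∏ₗ f i zero    = e
∏ₗ f i (suc l) = ⟦ f i ⟧ · ∏ₗ f (suc i) l

-- ⟦ f i ⟧ · … · ⟦ f (j ∸ 1) ⟧; the empty product when j ≤ i
∏ : (ℕ → Fin 2) → ℕ → ℕ → S₃
∏ f i j = ∏ₗ f i (j ∸ i)

∏ₗ-suc : ∀ f i l → ∏ₗ f (suc i) l ≡ ∏ₗ (f ∘ suc) i l
∏ₗ-suc f i zero    = refl
∏ₗ-suc f i (suc l) = cong (⟦ f (suc i) ⟧ ·_) (∏ₗ-suc f (suc i) l)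

∏ₗ-++ : ∀ f i l l′ → ∏ₗ f i (l + l′) ≡ ∏ₗ f i l · ∏ₗ f (i + l) l′
∏ₗ-++ f i zero    l′ rewrite +-identityʳ i = refl
∏ₗ-++ f i (suc l) l′ rewrite ∏ₗ-++ f (suc i) l l′ | +-suc i l = sym (·-assoc ⟦ f i ⟧ (∏ₗ f (suc i) l) _)

∏ₗ-cong : ∀ {f g} i l → Agree i (i + l) f g → ∏ₗ f i l ≡ ∏ₗ g i l
∏ₗ-cong i zero    f≐g = refl
∏ₗ-cong i (suc l) f≐g = cong₂ (λ x y → ⟦ x ⟧ · y) (f≐g i ≤-refl i<i+suc-l)
  (∏ₗ-cong (suc i) l λ w i<w w<i+l → f≐g w (<⇒≤ i<w) (subst (w <_) (sym (+-suc i l)) w<i+l))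
  where i<i+suc-l = subst (i <_) (sym (+-suc i l)) (s≤s (m≤m+n i l))

∏ₗ-allEven : ∀ i l → ∏ₗ (λ _ → even) i l ≡ a^ l
∏ₗ-allEven i zero    = refl
∏ₗ-allEven i (suc l) = cong (a ·_) (∏ₗ-allEven (suc i) l)

∸-suc : ∀ {i j} → i < j → j ∸ i ≡ suc (j ∸ suc i)
∸-suc {zero}  {suc j} _         = refl
∸-suc {suc i} {suc j} (s≤s i<j) = ∸-suc i<j

∏-empty : ∀ f i → ∏ f i i ≡ e
∏-empty f i rewrite n∸n≡0 i = refl

∏-cons : ∀ f {i j} → i < j → ∏ f i j ≡ ⟦ f i ⟧ · ∏ f (suc i) j
∏-cons f i<j rewrite ∸-suc i<j = refl

∏-++ : ∀ f {i k j} → i ≤ k → k ≤ j → ∏ f i j ≡ ∏ f i k · ∏ f k j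
∏-++ f {i} {k} {j} i≤k k≤j = begin
  ∏ₗ f i (j ∸ i)                            ≡⟨ cong (∏ₗ f i) j∸i≡ ⟩
  ∏ₗ f i ((k ∸ i) + (j ∸ k))                ≡⟨ ∏ₗ-++ f i (k ∸ i) (j ∸ k) ⟩
  ∏ₗ f i (k ∸ i) · ∏ₗ f (i + (k ∸ i)) (j ∸ k) ≡⟨ cong (λ k′ → ∏ f i k · ∏ₗ f k′ (j ∸ k)) (m+[n∸m]≡n i≤k) ⟩
  ∏ f i k · ∏ f k j                          ∎
  where
  open ≡-Reasoning
  j∸i≡ : j ∸ i ≡ (k ∸ i) + (j ∸ k)
  j∸i≡ = +-cancelˡ-≡ i _ _ (begin
    i + (j ∸ i)             ≡⟨ m+[n∸m]≡n (≤-trans i≤k k≤j) ⟩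
    j                       ≡⟨ m+[n∸m]≡n k≤j ⟨
    k + (j ∸ k)             ≡⟨ cong (_+ (j ∸ k)) (m+[n∸m]≡n i≤k) ⟨
    i + (k ∸ i) + (j ∸ k)   ≡⟨ +-assoc i (k ∸ i) (j ∸ k) ⟩
    i + ((k ∸ i) + (j ∸ k)) ∎)

∏-snoc : ∀ f {i k} → i ≤ k → ∏ f i (suc k) ≡ ∏ f i k · ⟦ f k ⟧
∏-snoc f {i} {k} i≤k = begin
  ∏ f i (suc k)                   ≡⟨ ∏-++ f i≤k (n≤1+n k) ⟩
  ∏ f i k · ∏ f k (suc k)         ≡⟨ cong (∏ f i k ·_) (∏-cons f (n<1+n k)) ⟩
  ∏ f i k · (⟦ f k ⟧ · ∏ f (suc k) (suc k)) ≡⟨ cong (λ g → ∏ f i k · (⟦ f k ⟧ · g)) (∏-empty f (suc k)) ⟩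
  ∏ f i k · (⟦ f k ⟧ · e)         ≡⟨ cong (∏ f i k ·_) (·-identityʳ ⟦ f k ⟧) ⟩
  ∏ f i k · ⟦ f k ⟧               ∎
  where open ≡-Reasoning

∏-cong : ∀ {f g i j} → i ≤ j → Agree i j f g → ∏ f i j ≡ ∏ g i j
∏-cong {i = i} {j} i≤j f≐g = ∏ₗ-cong i (j ∸ i) λ w i≤w w<j → f≐g w i≤w (subst (w <_) (m+[n∸m]≡n i≤j) w<j)

∏-allEven : ∀ {f i j} → i ≤ j → Agree i j f (λ _ → even) → ∏ f i j ≡ a^ (j ∸ i)
∏-allEven {i = i} {j} i≤j f≐even = trans (∏-cong i≤j f≐even) (∏ₗ-allEven i (j ∸ i))

𝟙 : Bool → ℕ
𝟙 true  = 1
𝟙 false = 0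

par : ∀ {i j} → Triangulation i j → ℕ → Fin 2
par t v = mod2 (quiddityAt t v)

length-filterᵇ-++ : ∀ {A : Set} (p : A → Bool) xs ys →
  length (filterᵇ p (xs ++ ys)) ≡ length (filterᵇ p xs) + length (filterᵇ p ys)
length-filterᵇ-++ p xs ys = trans (cong length (filter-++ (T? ∘ p) xs ys)) (length-++ (filterᵇ p xs))

quiddityAt-split : ∀ {i j} k (i<k : i < k) (k<j : k < j) (t₁ : Triangulation i k) (t₂ : Triangulation k j) v →
  quiddityAt (split k i<k k<j t₁ t₂) v ≡ 𝟙 (hasVertex v (i , k , j)) + (quiddityAt t₁ v + quiddityAt t₂ v)
quiddityAt-split {i} {j} k _ _ t₁ t₂ v with hasVertex v (i , k , j)
... | true  = cong suc (length-filterᵇ-++ (hasVertex v) (triangles t₁) (triangles t₂))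
... | false = length-filterᵇ-++ (hasVertex v) (triangles t₁) (triangles t₂)

≡ᵇ-refl : ∀ n → (n ≡ᵇ n) ≡ true
≡ᵇ-refl n = dec-true (n ≟ n) refl

hasVertex-none : ∀ {v i k j} → v ≢ i → v ≢ k → v ≢ j → hasVertex v (i , k , j) ≡ false
hasVertex-none {v} {i} {k} {j} v≢i v≢k v≢j
  rewrite dec-false (v ≟ i) v≢i | dec-false (v ≟ k) v≢k | dec-false (v ≟ j) v≢j = refl

<⇒≢ʳ : ∀ {m n} → n < m → m ≢ n
<⇒≢ʳ n<m = ≢-sym (<⇒≢ n<m)

quiddityAt-outside : ∀ {i j} (t : Triangulation i j) v → v < i ⊎ j < v → quiddityAt t v ≡ 0
quiddityAt-outside (edge _) v _ = refl
quiddityAt-outside {i} {j} (split k i<k k<j t₁ t₂) v v∉[i,j] rewrite quiddityAt-split k i<k k<j t₁ t₂ v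
  with v∉[i,j]
... | inj₁ v<i rewrite hasVertex-none (<⇒≢ v<i) (<⇒≢ (<-trans v<i i<k)) (<⇒≢ (<-trans v<i (<-trans i<k k<j)))
                     | quiddityAt-outside t₁ v (inj₁ v<i) | quiddityAt-outside t₂ v (inj₁ (<-trans v<i i<k)) = refl
... | inj₂ j<v rewrite hasVertex-none (<⇒≢ʳ (<-trans (<-trans i<k k<j) j<v)) (<⇒≢ʳ (<-trans k<j j<v)) (<⇒≢ʳ j<v)
                     | quiddityAt-outside t₁ v (inj₂ (<-trans k<j j<v)) | quiddityAt-outside t₂ v (inj₂ j<v) = refl

module _ {i j} k (i<k : i < k) (k<j : k < j) (t₁ : Triangulation i k) (t₂ : Triangulation k j) where
  private
    t = split k i<k k<j t₁ t₂

  quiddityAt-split-i : quiddityAt t i ≡ suc (quiddityAt t₁ i)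
  quiddityAt-split-i rewrite quiddityAt-split k i<k k<j t₁ t₂ i | ≡ᵇ-refl i
    | quiddityAt-outside t₂ i (inj₁ i<k) = cong suc (+-identityʳ _)

  quiddityAt-split-k : quiddityAt t k ≡ suc (quiddityAt t₁ k + quiddityAt t₂ k)
  quiddityAt-split-k rewrite quiddityAt-split k i<k k<j t₁ t₂ k | dec-false (k ≟ i) (<⇒≢ʳ i<k) | ≡ᵇ-refl k = refl

  quiddityAt-split-j : quiddityAt t j ≡ suc (quiddityAt t₂ j)
  quiddityAt-split-j rewrite quiddityAt-split k i<k k<j t₁ t₂ j | dec-false (j ≟ i) (<⇒≢ʳ (<-trans i<k k<j))
    | dec-false (j ≟ k) (<⇒≢ʳ k<j) | ≡ᵇ-refl j | quiddityAt-outside t₁ j (inj₂ k<j) = refl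

  quiddityAt-split-left : ∀ w → i < w → w < k → quiddityAt t w ≡ quiddityAt t₁ w
  quiddityAt-split-left w i<w w<k rewrite quiddityAt-split k i<k k<j t₁ t₂ w
    | hasVertex-none (<⇒≢ʳ i<w) (<⇒≢ w<k) (<⇒≢ (<-trans w<k k<j)) | quiddityAt-outside t₂ w (inj₁ w<k) = +-identityʳ _

  quiddityAt-split-right : ∀ w → k < w → w < j → quiddityAt t w ≡ quiddityAt t₂ w
  quiddityAt-split-right w k<w w<j rewrite quiddityAt-split k i<k k<j t₁ t₂ w
    | hasVertex-none (<⇒≢ʳ (<-trans i<k k<w)) (<⇒≢ʳ k<w) (<⇒≢ w<j) | quiddityAt-outside t₁ w (inj₂ k<w) = refl

  par-split-i : par t i ≡ toggle (par t₁ i)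
  par-split-i = trans (cong mod2 quiddityAt-split-i) (mod2-suc (quiddityAt t₁ i))

  par-split-k : par t k ≡ toggle (par t₁ k ⊕ par t₂ k)
  par-split-k = trans (cong mod2 quiddityAt-split-k)
    (trans (mod2-suc (quiddityAt t₁ k + quiddityAt t₂ k)) (cong toggle (mod2-+ (quiddityAt t₁ k) (quiddityAt t₂ k))))

  par-split-j : par t j ≡ toggle (par t₂ j)
  par-split-j = trans (cong mod2 quiddityAt-split-j) (mod2-suc (quiddityAt t₂ j))

  par-split-left : Agree (suc i) k (par t) (par t₁)
  par-split-left w i<w w<k = cong mod2 (quiddityAt-split-left w i<w w<k)

  par-split-right : Agree (suc k) j (par t) (par t₂)
  par-split-right w k<w w<j = cong mod2 (quiddityAt-split-right w k<w w<j)

ear : ∀ {i j} (t : Triangulation i j) → suc i < j → ∃[ w ] (i < w × w < j × quiddityAt t w ≡ 1)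
ear (edge refl) 1+i<1+i = ⊥-elim (n≮n _ 1+i<1+i)
ear (split k i<k k<j t₁ t₂) _ with suc _ <? k | suc k <? _
... | yes 1+i<k | _ with ear t₁ 1+i<k
...   | w , i<w , w<k , d≡1 = w , i<w , <-trans w<k k<j , trans (quiddityAt-split-left k i<k k<j t₁ t₂ w i<w w<k) d≡1
ear (split k i<k k<j t₁ t₂) _ | no _ | yes 1+k<j with ear t₂ 1+k<j
...   | w , k<w , w<j , d≡1 = w , <-trans i<k k<w , w<j , trans (quiddityAt-split-right k i<k k<j t₁ t₂ w k<w w<j) d≡1
ear (split k i<k k<j t₁ t₂) _ | no 1+i≮k | no 1+k≮j = k , i<k , k<j ,
  trans (quiddityAt-split-k k i<k k<j t₁ t₂) (cong suc (cong₂ _+_ (no-triangles t₁ 1+i≮k k) (no-triangles t₂ 1+k≮j k)))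
  where
  no-triangles : ∀ {i k} (t : Triangulation i k) → ¬ suc i < k → ∀ v → quiddityAt t v ≡ 0
  no-triangles (edge _)              _     _ = refl
  no-triangles (split l i<l l<k _ _) 1+i≮k _ = ⊥-elim (1+i≮k (≤-<-trans i<l l<k))

Trivial : Fin 2 → S₃ → Fin 2 → Set
Trivial x g y = ⟦ x ⟧ · (g · ⟦ y ⟧) ≡ e

-- The word x , f (i + 1) , … , f (j ∸ 1) , y of the sub-polygon i … j has trivial product.
-- The endpoint letters are separate because a part of a triangulation sees other
-- parities at its endpoints than the whole does.
Closes : ℕ → ℕ → (ℕ → Fin 2) → Fin 2 → Fin 2 → Set
Closes i j f x y = Trivial x (∏ f (suc i) j) y

-- Holds because ⟦ p ⟧ · ⟦ even ⟧ · ⟦ q ⟧ ≡ ⟦ p ⊕ q ⟧ (M(p) M(0) M(q) = M(p + q) for the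
-- frieze matrices), a · a ≡ e and b · b · b ≡ e.
glue : ∀ x₁ y₁ x₂ y₂ X Y → Trivial x₁ X y₁ → Trivial x₂ Y y₂ →
       Trivial (toggle x₁) (X · (⟦ toggle (y₁ ⊕ x₂) ⟧ · Y)) (toggle y₂)
glue = from-yes (all? λ x₁ → all? λ y₁ → all? λ x₂ → all? λ y₂ → all? λ X → all? λ Y →
  (⟦ x₁ ⟧ · (X · ⟦ y₁ ⟧) ≟ᶠ e) →-dec (⟦ x₂ ⟧ · (Y · ⟦ y₂ ⟧) ≟ᶠ e) →-dec
  (⟦ toggle x₁ ⟧ · ((X · (⟦ toggle (y₁ ⊕ x₂) ⟧ · Y)) · ⟦ toggle y₂ ⟧) ≟ᶠ e))

cut : ∀ x X z Y y y₁ → Trivial x (X · (⟦ z ⟧ · Y)) y → Trivial (toggle x) X y₁ →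
      Trivial (toggle (y₁ ⊕ z)) Y (toggle y)
cut = from-yes (all? λ x → all? λ X → all? λ z → all? λ Y → all? λ y → all? λ y₁ →
  (⟦ x ⟧ · ((X · (⟦ z ⟧ · Y)) · ⟦ y ⟧) ≟ᶠ e) →-dec (⟦ toggle x ⟧ · (X · ⟦ y₁ ⟧) ≟ᶠ e) →-dec
  (⟦ toggle (y₁ ⊕ z) ⟧ · (Y · ⟦ toggle y ⟧) ≟ᶠ e))

remove-ear : ∀ x X → Trivial x (X · ⟦ even ⟧) odd → Trivial (toggle x) X odd
remove-ear = from-yes (all? λ x → all? λ X →
  (⟦ x ⟧ · ((X · ⟦ even ⟧) · ⟦ odd ⟧) ≟ᶠ e) →-dec (⟦ toggle x ⟧ · (X · ⟦ odd ⟧) ≟ᶠ e))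

trivial-edge : ∀ x y → Trivial x e y → x ≡ even × y ≡ even
trivial-edge even even refl = refl , refl
trivial-edge even odd  ()
trivial-edge odd  even ()
trivial-edge odd  odd  ()

close-after-evens : ∀ g → g ≡ e ⊎ g ≡ a → ∃[ y₁ ] Trivial odd (g · ⟦ odd ⟧) y₁
close-after-evens = from-yes (all? λ g → ((g ≟ᶠ e) ⊎-dec (g ≟ᶠ a)) →-dec
  any? λ y₁ → ⟦ odd ⟧ · ((g · ⟦ odd ⟧) · ⟦ y₁ ⟧) ≟ᶠ e)

no-close-after-evens : ∀ g y → g ≡ e ⊎ g ≡ a → ¬ Trivial even (g · ⟦ odd ⟧) y
no-close-after-evens = from-yes (all? λ g → all? λ y → ((g ≟ᶠ e) ⊎-dec (g ≟ᶠ a)) →-dec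
  ¬? (⟦ even ⟧ · ((g · ⟦ odd ⟧) · ⟦ y ⟧) ≟ᶠ e))

toggle-⊕-toggle : ∀ y z → toggle (y ⊕ toggle (y ⊕ z)) ≡ z
toggle-⊕-toggle even even = refl
toggle-⊕-toggle even odd  = refl
toggle-⊕-toggle odd  even = refl
toggle-⊕-toggle odd  odd  = refl

∏-around : ∀ f {i k j} → i < k → k < j → ∏ f (suc i) j ≡ ∏ f (suc i) k · (⟦ f k ⟧ · ∏ f (suc k) j)
∏-around f {i} {k} i<k k<j = trans (∏-++ f i<k (<⇒≤ k<j)) (cong (∏ f (suc i) k ·_) (∏-cons f k<j))

par-closes : ∀ {i j} (t : Triangulation i j) → Closes i j (par t) (par t i) (par t j)
par-closes {i} (edge refl) rewrite ∏-empty (par (edge {i} refl)) (suc i) = refl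
par-closes {i} {j} (split k i<k k<j t₁ t₂)
  rewrite ∏-around (par (split k i<k k<j t₁ t₂)) i<k k<j | ∏-cong i<k (par-split-left k i<k k<j t₁ t₂)
        | ∏-cong k<j (par-split-right k i<k k<j t₁ t₂)
        | par-split-i k i<k k<j t₁ t₂ | par-split-k k i<k k<j t₁ t₂ | par-split-j k i<k k<j t₁ t₂
  = glue (par t₁ i) (par t₁ k) (par t₂ k) (par t₂ j) (∏ (par t₁) (suc i) k) (∏ (par t₂) (suc k) j) (par-closes t₁) (par-closes t₂)

-- Rules out the all-even word on more than two vertices: every triangulation has an ear.
Admissible : ℕ → ℕ → (ℕ → Fin 2) → Fin 2 → Fin 2 → Set
Admissible i j f x y = j ≡ suc i ⊎ x ≡ odd ⊎ y ≡ odd ⊎ ∃[ w ] (i < w × w < j × f w ≡ odd)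

Realization : ℕ → ℕ → (ℕ → Fin 2) → Fin 2 → Fin 2 → Set
Realization i j f x y = Σ (Triangulation i j) λ t → par t i ≡ x × Agree (suc i) j (par t) f × par t j ≡ y

-- The apex k of the triangle on the side (i , j), and the parity y₁ of k in the part i … k;
-- the boundary parities of the part k … j are then forced by the split.
record Apex (i j : ℕ) (f : ℕ → Fin 2) (x y : Fin 2) : Set where
  field
    k           : ℕ
    i<k         : i < k
    k<j         : k < j
    y₁          : Fin 2
    closes₁     : Closes i k f (toggle x) y₁
    admissible₁ : Admissible i k f (toggle x) y₁
    admissible₂ : Admissible k j f (toggle (y₁ ⊕ f k)) (toggle y)

first-odd : ∀ f i j → Agree i j f (λ _ → even) ⊎ ∃[ v ] (i ≤ v × v < j × f v ≡ odd × Agree i v f (λ _ → even))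
first-odd f i zero = inj₁ λ _ _ ()
first-odd f i (suc j) with first-odd f i j
... | inj₂ (v , i≤v , v<j , fv≡odd , even<v) = inj₂ (v , i≤v , m<n⇒m<1+n v<j , fv≡odd , even<v)
... | inj₁ even<j with f j in fj | i ≤? j
...   | odd  | yes i≤j = inj₂ (j , i≤j , n<1+n j , fj , even<j)
...   | odd  | no  i≰j = inj₁ (Agree-extend even<j λ i≤j → ⊥-elim (i≰j i≤j))
...   | even | _       = inj₁ (Agree-extend even<j λ _ → fj)

admissible-right : ∀ {f k m x′ y} → k ≤ m → y ≡ even ⊎ f m ≡ odd → Admissible k (suc m) f x′ (toggle y)
admissible-right _ (inj₁ refl) = inj₂ (inj₂ (inj₁ refl))
admissible-right {m = m} k≤m (inj₂ fm≡odd) with m≤n⇒m<n∨m≡n k≤m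
... | inj₁ k<m  = inj₂ (inj₂ (inj₂ (m , k<m , n<1+n m , fm≡odd)))
... | inj₂ refl = inj₁ refl

apex-at-ear : ∀ {i m f x} → i < m → f m ≡ even → Closes i (suc m) f x odd → Apex i (suc m) f x odd
apex-at-ear {i} {m} {f} {x} i<m fm≡even closes = record
  { k = m ; i<k = i<m ; k<j = n<1+n m ; y₁ = odd
  ; closes₁     = remove-ear x (∏ f (suc i) m) (subst (λ g → Trivial x g odd) word closes)
  ; admissible₁ = inj₂ (inj₂ (inj₁ refl))
  ; admissible₂ = inj₁ refl
  }
  where
  word : ∏ f (suc i) (suc m) ≡ ∏ f (suc i) m · ⟦ even ⟧
  word = trans (∏-snoc f i<m) (cong (λ d → ∏ f (suc i) m · ⟦ d ⟧) fm≡even)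

odd-at-end : ∀ {i m f y} → i < m → Agree (suc i) m f (λ _ → even) → Admissible i (suc m) f even y →
             y ≡ even ⊎ f m ≡ odd → f m ≡ odd
odd-at-end i<m _ (inj₁ 1+m≡1+i) _ = ⊥-elim (<⇒≢ i<m (sym (suc-injective 1+m≡1+i)))
odd-at-end _ _ (inj₂ (inj₂ (inj₁ refl))) (inj₂ fm≡odd) = fm≡odd
odd-at-end {m = m} _ even<m (inj₂ (inj₂ (inj₂ (w , i<w , w<1+m , fw≡odd)))) _ with m≤n⇒m<n∨m≡n (≤-pred w<1+m)
... | inj₁ w<m with () ← trans (sym (even<m w i<w w<m)) fw≡odd
... | inj₂ refl = fw≡odd

-- If x is odd, i is made an ear (k = i + 1).  Otherwise k follows the first odd letter v, so the
-- part i … k reads b , a , … , a , b , y₁ and y₁ can be chosen to close it.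
apex-after-first-odd : ∀ {i m f x y} → i < m → Closes i (suc m) f x y → Admissible i (suc m) f x y →
                       y ≡ even ⊎ f m ≡ odd → Apex i (suc m) f x y
apex-after-first-odd {i} {m} {f} {odd} i<m _ _ y≡even⊎fm≡odd = record
  { k = suc i ; i<k = n<1+n i ; k<j = s≤s i<m ; y₁ = even
  ; closes₁     = subst (λ g → Trivial even g even) (sym (∏-empty f (suc i))) refl
  ; admissible₁ = inj₁ refl
  ; admissible₂ = admissible-right i<m y≡even⊎fm≡odd
  }
apex-after-first-odd {i} {m} {f} {even} {y} i<m closes adm y≡even⊎fm≡odd with first-odd f (suc i) m
... | inj₂ (v , i<v , v<m , fv≡odd , even<v) = record
  { k = suc v ; i<k = m<n⇒m<1+n i<v ; k<j = s≤s v<m ; y₁ = proj₁ closing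
  ; closes₁     = subst (λ g → Trivial odd g (proj₁ closing)) (sym word) (proj₂ closing)
  ; admissible₁ = inj₂ (inj₂ (inj₂ (v , i<v , n<1+n v , fv≡odd)))
  ; admissible₂ = admissible-right v<m y≡even⊎fm≡odd
  }
  where
  word : ∏ f (suc i) (suc v) ≡ a^ (v ∸ suc i) · ⟦ odd ⟧
  word = trans (∏-snoc f i<v) (cong₂ (λ g d → g · ⟦ d ⟧) (∏-allEven i<v even<v) fv≡odd)
  closing : ∃[ y₁ ] Trivial odd (a^ (v ∸ suc i) · ⟦ odd ⟧) y₁
  closing = close-after-evens _ (a^-cases (v ∸ suc i))
... | inj₁ even<m = ⊥-elim (no-close-after-evens (a^ (m ∸ suc i)) y (a^-cases (m ∸ suc i))
                                                   (subst (λ g → Trivial even g y) word closes))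
  where
  word : ∏ f (suc i) (suc m) ≡ a^ (m ∸ suc i) · ⟦ odd ⟧
  word = trans (∏-snoc f i<m) (cong₂ (λ g d → g · ⟦ d ⟧) (∏-allEven i<m even<m) (odd-at-end i<m even<m adm y≡even⊎fm≡odd))

apex : ∀ {i m f x y} → i < m → Closes i (suc m) f x y → Admissible i (suc m) f x y → Apex i (suc m) f x y
apex {y = even} i<m closes adm = apex-after-first-odd i<m closes adm (inj₁ refl)
apex {m = m} {f} {y = odd} i<m closes adm with f m in fm
... | even = apex-at-ear i<m fm closes
... | odd  = apex-after-first-odd i<m closes adm (inj₂ fm)

realize-edge : ∀ {i f x y} → Closes i (suc i) f x y → Realization i (suc i) f x y
realize-edge {i} {f} {x} {y} closes
  with trivial-edge x y (subst (λ g → Trivial x g y) (∏-empty f (suc i)) closes)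
... | refl , refl = edge refl , refl , (λ w 1+i≤w w<1+i → ⊥-elim (n≮n w (<-≤-trans w<1+i 1+i≤w))) , refl

assemble : ∀ {i k j f x y y₁} (i<k : i < k) (k<j : k < j) →
           Realization i k f (toggle x) y₁ → Realization k j f (toggle (y₁ ⊕ f k)) (toggle y) →
           Realization i j f x y
assemble {i} {k} {j} {f} {x} {y} {y₁} i<k k<j (t₁ , t₁-i , t₁-agrees , t₁-k) (t₂ , t₂-k , t₂-agrees , t₂-j) =
  t , parity-i , agrees , parity-j
  where
  t = split k i<k k<j t₁ t₂
  parity-i : par t i ≡ x
  parity-i = trans (par-split-i k i<k k<j t₁ t₂) (trans (cong toggle t₁-i) (toggle-involutive x))
  parity-j : par t j ≡ y
  parity-j = trans (par-split-j k i<k k<j t₁ t₂) (trans (cong toggle t₂-j) (toggle-involutive y))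
  agrees : Agree (suc i) j (par t) f
  agrees w i<w w<j with <-cmp w k
  ... | tri< w<k _ _ = trans (par-split-left k i<k k<j t₁ t₂ w i<w w<k) (t₁-agrees w i<w w<k)
  ... | tri> _ _ k<w = trans (par-split-right k i<k k<j t₁ t₂ w k<w w<j) (t₂-agrees w k<w w<j)
  ... | tri≈ _ refl _ = trans (par-split-k k i<k k<j t₁ t₂)
                              (trans (cong₂ (λ p q → toggle (p ⊕ q)) t₁-k t₂-k) (toggle-⊕-toggle y₁ (f k)))

realize : ∀ n {i j f x y} → i < j → j ≤ i + n → Closes i j f x y → Admissible i j f x y → Realization i j f x y
realize zero    {i} i<j j≤i+0 _ _ = ⊥-elim (<⇒≱ i<j (subst (_ ≤_) (+-identityʳ i) j≤i+0))
realize (suc n) {i} {suc m} {f} {x} {y} i<1+m 1+m≤i+1+n closes adm with m≤n⇒m<n∨m≡n (≤-pred i<1+m)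
... | inj₂ refl = realize-edge closes
... | inj₁ i<m  = assemble i<k k<j (realize n i<k k≤i+n closes₁ admissible₁)
                                   (realize n k<j 1+m≤k+n closes₂ admissible₂)
  where
  open Apex (apex i<m closes adm)
  k≤i+n : k ≤ i + n
  k≤i+n = ≤-pred (≤-trans k<j (subst (suc m ≤_) (+-suc i n) 1+m≤i+1+n))
  1+m≤k+n : suc m ≤ k + n
  1+m≤k+n = ≤-trans (subst (suc m ≤_) (+-suc i n) 1+m≤i+1+n) (+-monoˡ-≤ n i<k)
  closes₂ : Closes k (suc m) f (toggle (y₁ ⊕ f k)) (toggle y)
  closes₂ = cut x (∏ f (suc i) k) (f k) (∏ f (suc k) (suc m)) y y₁
                (subst (λ g → Trivial x g y) (∏-around f i<k k<j) closes) closes₁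

at : ∀ {n} → Vec (Fin 2) n → ℕ → Fin 2
at []      _       = even
at (x ∷ s) zero    = x
at (x ∷ s) (suc w) = at s w

∏ᵥ : ∀ {n} → Vec (Fin 2) n → S₃
∏ᵥ []      = e
∏ᵥ (x ∷ s) = ⟦ x ⟧ · ∏ᵥ s

∏ᵥ≡∏ : ∀ {n} (s : Vec (Fin 2) n) → ∏ᵥ s ≡ ∏ (at s) 0 n
∏ᵥ≡∏ []              = refl
∏ᵥ≡∏ {suc n} (x ∷ s) = cong (⟦ x ⟧ ·_) (trans (∏ᵥ≡∏ s) (sym (∏ₗ-suc (at (x ∷ s)) 0 n)))

at-tabulate : ∀ {n} (h : Fin n → Fin 2) w (w<n : w < n) → at (tabulate h) w ≡ h (fromℕ< w<n)
at-tabulate {suc n} h zero    _         = refl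
at-tabulate {suc n} h (suc w) (s≤s w<n) = at-tabulate (h ∘ fsuc) w w<n

at-paritySequence : ∀ n (t : PolygonTriangulation n) w → w < n → at (paritySequence n t) w ≡ par t w
at-paritySequence n t w w<n = trans (at-tabulate _ w w<n) (cong (mod2 ∘ quiddityAt t) (toℕ-fromℕ< w<n))

at-injective : ∀ {n} (s s′ : Vec (Fin 2) n) → (∀ w → w < n → at s w ≡ at s′ w) → s ≡ s′
at-injective []      []        _     = refl
at-injective (x ∷ s) (x′ ∷ s′) s≐s′ = cong₂ _∷_ (s≐s′ 0 (s≤s z≤n)) (at-injective s s′ λ w w<n → s≐s′ (suc w) (s≤s w<n))

∈⇒at : ∀ {n} {s : Vec (Fin 2) n} → odd ∈ s → ∃[ w ] (w < n × at s w ≡ odd)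
∈⇒at (here refl) = 0 , s≤s z≤n , refl
∈⇒at (there odd∈s) with ∈⇒at odd∈s
... | w , w<n , sw≡odd = suc w , s≤s w<n , sw≡odd

at⇒∈ : ∀ {n} (s : Vec (Fin 2) n) w → w < n → at s w ≡ odd → odd ∈ s
at⇒∈ (x ∷ s) zero    _         refl = here refl
at⇒∈ (x ∷ s) (suc w) (s≤s w<n) sw≡odd = there (at⇒∈ s w w<n sw≡odd)

∏-boundary : ∀ f {j} → 0 < j → ∏ f 0 (suc j) ≡ ⟦ f 0 ⟧ · (∏ f 1 j · ⟦ f j ⟧)
∏-boundary f {j} 0<j = trans (∏-cons f {0} {suc j} (s≤s z≤n)) (cong (⟦ f 0 ⟧ ·_) (∏-snoc f 0<j))

IsParityWord : ∀ {n} → Vec (Fin 2) n → Set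
IsParityWord s = ∏ᵥ s ≡ e × odd ∈ s

paritySequence-isParityWord : ∀ j → 2 ≤ j → (t : PolygonTriangulation (suc j)) → IsParityWord (paritySequence (suc j) t)
paritySequence-isParityWord j 2≤j t = product , odd-vertex
  where
  s = paritySequence (suc j) t
  product : ∏ᵥ s ≡ e
  product = begin
    ∏ᵥ s                                        ≡⟨ ∏ᵥ≡∏ s ⟩
    ∏ (at s) 0 (suc j)                          ≡⟨ ∏-cong z≤n (λ w _ → at-paritySequence (suc j) t w) ⟩
    ∏ (par t) 0 (suc j)                         ≡⟨ ∏-boundary (par t) (<-trans (s≤s z≤n) 2≤j) ⟩
    ⟦ par t 0 ⟧ · (∏ (par t) 1 j · ⟦ par t j ⟧) ≡⟨ par-closes t ⟩
    e                                           ∎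
    where open ≡-Reasoning
  odd-vertex : odd ∈ s
  odd-vertex with ear t 2≤j
  ... | w , _ , w<j , d≡1 = at⇒∈ s w (m<n⇒m<1+n w<j)
                                  (trans (at-paritySequence (suc j) t w (m<n⇒m<1+n w<j)) (cong mod2 d≡1))

isParityWord⇒isParitySequence : ∀ j → 2 ≤ j → (s : Vec (Fin 2) (suc j)) → IsParityWord s → IsParitySequence (suc j) s
isParityWord⇒isParitySequence j 2≤j s (product , odd∈s) = realized (realize j 0<j ≤-refl closes-s admissible)
  where
  f = at s
  0<j = <-trans (s≤s z≤n) 2≤j
  closes-s : Closes 0 j f (f 0) (f j)
  closes-s = trans (sym (∏-boundary f 0<j)) (trans (sym (∏ᵥ≡∏ s)) product)
  admissible : Admissible 0 j f (f 0) (f j)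
  admissible with ∈⇒at odd∈s
  ... | zero  , _ , f0≡odd = inj₂ (inj₁ f0≡odd)
  ... | suc w , 1+w<1+j , fw≡odd with m≤n⇒m<n∨m≡n (≤-pred 1+w<1+j)
  ...   | inj₁ 1+w<j = inj₂ (inj₂ (inj₂ (suc w , s≤s z≤n , 1+w<j , fw≡odd)))
  ...   | inj₂ refl  = inj₂ (inj₂ (inj₁ fw≡odd))
  realized : Realization 0 j f (f 0) (f j) → IsParitySequence (suc j) s
  realized (t , t-0 , t-agrees , t-j) = t , at-injective _ _ agrees
    where
    agrees : ∀ w → w < suc j → at (paritySequence (suc j) t) w ≡ f w
    agrees zero    w<1+j = trans (at-paritySequence (suc j) t 0 w<1+j) t-0
    agrees (suc w) 1+w<1+j with m≤n⇒m<n∨m≡n (≤-pred 1+w<1+j)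
    ... | inj₁ 1+w<j = trans (at-paritySequence (suc j) t (suc w) 1+w<1+j) (t-agrees (suc w) (s≤s z≤n) 1+w<j)
    ... | inj₂ refl  = trans (at-paritySequence (suc j) t (suc w) 1+w<1+j) t-j

words : (n : ℕ) → List (Vec (Fin 2) n)
words zero    = [] ∷ []
words (suc n) = map (even ∷_) (words n) ++ map (odd ∷_) (words n)

words-unique : ∀ n → Unique (words n)
words-unique zero    = All.[] AllPairs.∷ AllPairs.[]
words-unique (suc n) = Unique.++⁺ (Unique.map⁺ ∷-injectiveʳ (words-unique n)) (Unique.map⁺ ∷-injectiveʳ (words-unique n))
  λ (p , q) → first-letters-differ (∈-map⁻ (even ∷_) p) (∈-map⁻ (odd ∷_) q)
  where
  first-letters-differ : ∀ {s : Vec (Fin 2) (suc n)} →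
    ∃[ r ] (r List.∈ words n × s ≡ even ∷ r) → ∃[ r ] (r List.∈ words n × s ≡ odd ∷ r) → ⊥
  first-letters-differ (_ , _ , refl) (_ , _ , ())

∈-words : ∀ {n} (s : Vec (Fin 2) n) → s List.∈ words n
∈-words []           = hereₗ refl
∈-words (even ∷ s)   = ∈-++⁺ˡ (∈-map⁺ (even ∷_) (∈-words s))
∈-words {suc n} (odd ∷ s) = ∈-++⁺ʳ (map (even ∷_) (words n)) (∈-map⁺ (odd ∷_) (∈-words s))

count : ∀ n {P : Vec (Fin 2) n → Set} → Decidable P → ℕ
count n P? = length (filter P? (words n))

length-filter-map : ∀ {A B : Set} {P : B → Set} (P? : Decidable P) (f : A → B) xs →
                    length (filter P? (map f xs)) ≡ length (filter (P? ∘ f) xs)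
length-filter-map P? f []       = refl
length-filter-map P? f (x ∷ xs) with does (P? (f x))
... | true  = cong suc (length-filter-map P? f xs)
... | false = length-filter-map P? f xs

count-suc : ∀ n {P : Vec (Fin 2) (suc n) → Set} (P? : Decidable P) →
            count (suc n) P? ≡ count n (P? ∘ (even ∷_)) + count n (P? ∘ (odd ∷_))
count-suc n P? = begin
  length (filter P? (map (even ∷_) (words n) ++ map (odd ∷_) (words n)))
    ≡⟨ cong length (filter-++ P? (map (even ∷_) (words n)) (map (odd ∷_) (words n))) ⟩
  length (filter P? (map (even ∷_) (words n)) ++ filter P? (map (odd ∷_) (words n)))
    ≡⟨ length-++ (filter P? (map (even ∷_) (words n))) ⟩
  length (filter P? (map (even ∷_) (words n))) + length (filter P? (map (odd ∷_) (words n)))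
    ≡⟨ cong₂ _+_ (length-filter-map P? (even ∷_) (words n)) (length-filter-map P? (odd ∷_) (words n)) ⟩
  count n (P? ∘ (even ∷_)) + count n (P? ∘ (odd ∷_)) ∎
  where open ≡-Reasoning

count-≐ : ∀ n {P Q : Vec (Fin 2) n → Set} (P? : Decidable P) (Q? : Decidable Q) → P ≐ Q → count n P? ≡ count n Q?
count-≐ n P? Q? P≐Q = cong length (filter-≐ P? Q? P≐Q (words n))

isParityWord? : ∀ {n} → Decidable (IsParityWord {n})
isParityWord? s = (∏ᵥ s ≟ᶠ e) ×-dec (odd ∈? s)

numParitySequences-count : ∀ n → 3 ≤ n → NumParitySequences n (count n isParityWord?)
numParitySequences-count (suc j) (s≤s 2≤j) =
  filter isParityWord? (words (suc j)) ,
  Unique.filter⁺ isParityWord? (words-unique (suc j)) ,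
  (λ s → mk⇔ (λ s∈L → isParityWord⇒isParitySequence j 2≤j s (proj₂ (∈-filter⁻ isParityWord? {xs = words (suc j)} s∈L)))
             (λ { (t , refl) → ∈-filter⁺ isParityWord? (∈-words _) (paritySequence-isParityWord j 2≤j t) })) ,
  refl

#∏ : ℕ → S₃ → ℕ
#∏ n g = count n λ s → ∏ᵥ s ≟ᶠ g

#∏-with-odd : ℕ → S₃ → ℕ
#∏-with-odd n g = count n λ s → (∏ᵥ s ≟ᶠ g) ×-dec (odd ∈? s)

_⁻¹ : S₃ → S₃
e   ⁻¹ = e
a   ⁻¹ = a
b   ⁻¹ = b²
b²  ⁻¹ = b
ab  ⁻¹ = ab
ab² ⁻¹ = ab²

·-moveˡ : ∀ x h g → x · h ≡ g → h ≡ x ⁻¹ · g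
·-moveˡ = from-yes (all? λ x → all? λ h → all? λ g → (x · h ≟ᶠ g) →-dec (h ≟ᶠ x ⁻¹ · g))

·-moveˡ⁻ : ∀ x h g → h ≡ x ⁻¹ · g → x · h ≡ g
·-moveˡ⁻ = from-yes (all? λ x → all? λ h → all? λ g → (h ≟ᶠ x ⁻¹ · g) →-dec (x · h ≟ᶠ g))

∏ᵥ-∷≡ : ∀ {n} x g → (λ (s : Vec (Fin 2) n) → ∏ᵥ (x ∷ s) ≡ g) ≐ (λ s → ∏ᵥ s ≡ ⟦ x ⟧ ⁻¹ · g)
∏ᵥ-∷≡ x g = (λ {s} → ·-moveˡ ⟦ x ⟧ (∏ᵥ s) g) , (λ {s} → ·-moveˡ⁻ ⟦ x ⟧ (∏ᵥ s) g)

#∏-suc : ∀ n g → #∏ (suc n) g ≡ #∏ n (a · g) + #∏ n (b² · g)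
#∏-suc n g = trans (count-suc n (λ s → ∏ᵥ s ≟ᶠ g))
  (cong₂ _+_ (count-≐ n (λ s → a · ∏ᵥ s ≟ᶠ g) (λ s → ∏ᵥ s ≟ᶠ a · g) (∏ᵥ-∷≡ even g))
             (count-≐ n (λ s → b · ∏ᵥ s ≟ᶠ g) (λ s → ∏ᵥ s ≟ᶠ b² · g) (∏ᵥ-∷≡ odd g)))

#∏-with-odd-suc : ∀ n g → #∏-with-odd (suc n) g ≡ #∏-with-odd n (a · g) + #∏ n (b² · g)
#∏-with-odd-suc n g = trans (count-suc n (λ s → (∏ᵥ s ≟ᶠ g) ×-dec (odd ∈? s)))
  (cong₂ _+_ (count-≐ n (λ s → (a · ∏ᵥ s ≟ᶠ g) ×-dec (odd ∈? even ∷ s)) (λ s → (∏ᵥ s ≟ᶠ a · g) ×-dec (odd ∈? s))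
                      ((λ {s} (p , odd∈) → proj₁ (∏ᵥ-∷≡ even g) {s} p , drop-even odd∈) ,
                       (λ {s} (p , odd∈) → proj₂ (∏ᵥ-∷≡ even g) {s} p , there odd∈)))
             (count-≐ n (λ s → (b · ∏ᵥ s ≟ᶠ g) ×-dec (odd ∈? odd ∷ s)) (λ s → ∏ᵥ s ≟ᶠ b² · g)
                      ((λ {s} (p , _) → proj₁ (∏ᵥ-∷≡ odd g) {s} p) , (λ {s} p → proj₂ (∏ᵥ-∷≡ odd g) {s} p , here refl))))
  where
  drop-even : ∀ {s : Vec (Fin 2) n} → odd ∈ even ∷ s → odd ∈ s
  drop-even (there odd∈s) = odd∈s

does-a·≟ : ∀ h g → does (a · h ≟ᶠ g) ≡ does (h ≟ᶠ a · g)
does-a·≟ = from-yes (all? λ h → all? λ g → does (a · h ≟ᶠ g) Bool.≟ does (h ≟ᶠ a · g))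

-- The all-even word is the only one without an odd letter; its product is a^ n.
#∏-with-odd+𝟙 : ∀ n g → #∏-with-odd n g + 𝟙 (does (a^ n ≟ᶠ g)) ≡ #∏ n g
#∏-with-odd+𝟙 zero    = from-yes (all? λ g → #∏-with-odd 0 g + 𝟙 (does (e ≟ᶠ g)) ≟ #∏ 0 g)
#∏-with-odd+𝟙 (suc n) g = begin
  #∏-with-odd (suc n) g + 𝟙 (does (a · a^ n ≟ᶠ g))
    ≡⟨ cong₂ _+_ (#∏-with-odd-suc n g) (cong 𝟙 (does-a·≟ (a^ n) g)) ⟩
  #∏-with-odd n (a · g) + #∏ n (b² · g) + 𝟙 (does (a^ n ≟ᶠ a · g))
    ≡⟨ xy∙z≈xz∙y (#∏-with-odd n (a · g)) _ _ ⟩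
  #∏-with-odd n (a · g) + 𝟙 (does (a^ n ≟ᶠ a · g)) + #∏ n (b² · g)
    ≡⟨ cong (_+ #∏ n (b² · g)) (#∏-with-odd+𝟙 n (a · g)) ⟩
  #∏ n (a · g) + #∏ n (b² · g)
    ≡⟨ #∏-suc n g ⟨
  #∏ (suc n) g ∎
  where open ≡-Reasoning

counts-step : ℕ × ℕ → ℕ × ℕ
counts-step (u , v) = u + v , u + u

-- For each g, the number of words of length k + 1 with product g is proj₂ (counts k)
-- if g ∈ {a , b} and proj₁ (counts k) otherwise.
counts : ℕ → ℕ × ℕ
counts zero    = 0 , 1
counts (suc k) = counts-step (counts k)

byClass : ℕ × ℕ → S₃ → ℕ
byClass (u , v) a = v
byClass (u , v) b = v
byClass (u , v) _ = u

byClass-step : ∀ c g → byClass c (a · g) + byClass c (b² · g) ≡ byClass (counts-step c) g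
byClass-step (u , v) e   = +-comm v u
byClass-step (u , v) a   = refl
byClass-step (u , v) b   = refl
byClass-step (u , v) b²  = refl
byClass-step (u , v) ab  = +-comm v u
byClass-step (u , v) ab² = refl

#∏-byClass : ∀ k g → #∏ (suc k) g ≡ byClass (counts k) g
#∏-byClass zero    = from-yes (all? λ g → #∏ 1 g ≟ byClass (0 , 1) g)
#∏-byClass (suc k) g = begin
  #∏ (suc (suc k)) g                                          ≡⟨ #∏-suc (suc k) g ⟩
  #∏ (suc k) (a · g) + #∏ (suc k) (b² · g)                    ≡⟨ cong₂ _+_ (#∏-byClass k (a · g)) (#∏-byClass k (b² · g)) ⟩
  byClass (counts k) (a · g) + byClass (counts k) (b² · g)    ≡⟨ byClass-step (counts k) g ⟩
  byClass (counts (suc k)) g                                  ∎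
  where open ≡-Reasoning

[_]₄ : ℕ → ℕ
[ zero  ]₄ = 0
[ suc k ]₄ = suc (4 * [ k ]₄)

3*[k]₄+1≡4^k : ∀ k → 3 * [ k ]₄ + 1 ≡ 4 ^ k
3*[k]₄+1≡4^k zero    = refl
3*[k]₄+1≡4^k (suc k) = trans (3[1+4x]+1≡4[3x+1] [ k ]₄) (cong (4 *_) (3*[k]₄+1≡4^k k))
  where
  3[1+4x]+1≡4[3x+1] : ∀ x → 3 * suc (4 * x) + 1 ≡ 4 * (3 * x + 1)
  3[1+4x]+1≡4[3x+1] = solve-∀

counts-double : ∀ k → counts (k + k) ≡ ([ k ]₄ , suc [ k ]₄)
counts-double zero    = refl
counts-double (suc k) rewrite +-suc k k | counts-double k = cong₂ _,_ (x+[1+x]+[x+x]≡1+4x [ k ]₄) (x+[1+x]+[x+[1+x]]≡2+4x [ k ]₄)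
  where
  x+[1+x]+[x+x]≡1+4x : ∀ x → (x + suc x) + (x + x) ≡ suc (4 * x)
  x+[1+x]+[x+x]≡1+4x = solve-∀
  x+[1+x]+[x+[1+x]]≡2+4x : ∀ x → (x + suc x) + (x + suc x) ≡ suc (suc (4 * x))
  x+[1+x]+[x+[1+x]]≡2+4x = solve-∀

#parityWords-odd : ∀ k → count (suc (k + k)) isParityWord? ≡ [ k ]₄
#parityWords-odd k = begin
  #∏-with-odd (suc (k + k)) e                                   ≡⟨ +-identityʳ _ ⟨
  #∏-with-odd (suc (k + k)) e + 𝟙 (does (a · e ≟ᶠ e))           ≡⟨ cong (λ g → #∏-with-odd (suc (k + k)) e + 𝟙 (does (a · g ≟ᶠ e))) (a^-double k) ⟨
  #∏-with-odd (suc (k + k)) e + 𝟙 (does (a^ suc (k + k) ≟ᶠ e))  ≡⟨ #∏-with-odd+𝟙 (suc (k + k)) e ⟩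
  #∏ (suc (k + k)) e                                            ≡⟨ #∏-byClass (k + k) e ⟩
  byClass (counts (k + k)) e                                    ≡⟨ cong (λ c → byClass c e) (counts-double k) ⟩
  [ k ]₄                                                        ∎
  where open ≡-Reasoning

#parityWords-even : ∀ m → count (suc (suc (m + m))) isParityWord? ≡ [ m ]₄ + [ m ]₄
#parityWords-even m = suc-injective (begin
  suc (#∏-with-odd n e)                                 ≡⟨ +-comm 1 _ ⟩
  #∏-with-odd n e + 𝟙 (does (a · (a · e) ≟ᶠ e))         ≡⟨ cong (λ g → #∏-with-odd n e + 𝟙 (does (a · (a · g) ≟ᶠ e))) (a^-double m) ⟨
  #∏-with-odd n e + 𝟙 (does (a^ n ≟ᶠ e))                ≡⟨ #∏-with-odd+𝟙 n e ⟩
  #∏ n e                                                ≡⟨ #∏-byClass (suc (m + m)) e ⟩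
  byClass (counts-step (counts (m + m))) e              ≡⟨ cong (λ c → byClass (counts-step c) e) (counts-double m) ⟩
  [ m ]₄ + suc [ m ]₄                                   ≡⟨ +-suc [ m ]₄ [ m ]₄ ⟩
  suc ([ m ]₄ + [ m ]₄)                                 ∎)
  where
  open ≡-Reasoning
  n = suc (suc (m + m))

qInt-4 : ∀ k → qInt 4 k ≡ [ k ]₄
qInt-4 k = begin
  (4 ^ k ∸ 1) / 3           ≡⟨ cong (λ x → (x ∸ 1) / 3) (3*[k]₄+1≡4^k k) ⟨
  (3 * [ k ]₄ + 1 ∸ 1) / 3  ≡⟨ cong (_/ 3) (trans (m+n∸n≡m (3 * [ k ]₄) 1) (*-comm 3 [ k ]₄)) ⟩
  [ k ]₄ * 3 / 3            ≡⟨ m*n/n≡m [ k ]₄ 3 ⟩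
  [ k ]₄                    ∎
  where open ≡-Reasoning

4^≡2^*2^ : ∀ m → 4 ^ m ≡ 2 ^ m * 2 ^ m
4^≡2^*2^ zero    = refl
4^≡2^*2^ (suc m) = trans (cong (4 *_) (4^≡2^*2^ m)) (4[p*p]≡2p*2p (2 ^ m))
  where
  4[p*p]≡2p*2p : ∀ p → 4 * (p * p) ≡ (2 * p) * (2 * p)
  4[p*p]≡2p*2p = solve-∀

-- With p = q + 1: (2p − 1)(p − 1) = 3(2X − q) when 3X + 1 = p².
qBinom2-arith : ∀ p X → 1 ≤ p → 3 * X + 1 ≡ p * p → (2 * p ∸ 1) * (p ∸ 1) / 3 + p ∸ 1 ≡ X + X
qBinom2-arith (suc q) X _ 3X+1≡p² = begin
  (2 * suc q ∸ 1) * q / 3 + suc q ∸ 1  ≡⟨ cong (λ x → x * q / 3 + suc q ∸ 1) 2p∸1≡2q+1 ⟩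
  c / 3 + suc q ∸ 1                    ≡⟨ cong (_∸ 1) (+-suc (c / 3) q) ⟩
  c / 3 + q                            ≡⟨ cong (c / 3 +_) (m*n/n≡m q 3) ⟨
  c / 3 + q * 3 / 3                    ≡⟨ +-distrib-/-∣ʳ c (n∣m*n q) ⟨
  (c + q * 3) / 3                      ≡⟨ cong (_/ 3) c+3q≡6X ⟩
  (X + X) * 3 / 3                      ≡⟨ m*n/n≡m (X + X) 3 ⟩
  X + X                                ∎
  where
  open ≡-Reasoning
  c = (2 * q + 1) * q
  2p∸1≡2q+1 : 2 * suc q ∸ 1 ≡ 2 * q + 1
  2p∸1≡2q+1 = cong (_∸ 1) (2[1+q]≡1+[2q+1] q)
    where
    2[1+q]≡1+[2q+1] : ∀ q → 2 * suc q ≡ suc (2 * q + 1)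
    2[1+q]≡1+[2q+1] = solve-∀
  c+3q≡6X : c + q * 3 ≡ (X + X) * 3
  c+3q≡6X = +-cancelʳ-≡ 2 _ _ (begin
    c + q * 3 + 2        ≡⟨ [2q+1]q+3q+2≡2[1+q]² q ⟩
    2 * (suc q * suc q)  ≡⟨ cong (2 *_) 3X+1≡p² ⟨
    2 * (3 * X + 1)      ≡⟨ 2[3x+1]≡[x+x]3+2 X ⟩
    (X + X) * 3 + 2      ∎)
    where
    [2q+1]q+3q+2≡2[1+q]² : ∀ q → (2 * q + 1) * q + q * 3 + 2 ≡ 2 * (suc q * suc q)
    [2q+1]q+3q+2≡2[1+q]² = solve-∀
    2[3x+1]≡[x+x]3+2 : ∀ x → 2 * (3 * x + 1) ≡ (x + x) * 3 + 2
    2[3x+1]≡[x+x]3+2 = solve-∀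

qBinom2-2 : ∀ m → qBinom2 2 (suc m) + 2 ^ (suc m ∸ 1) ∸ 1 ≡ [ m ]₄ + [ m ]₄
qBinom2-2 m = qBinom2-arith (2 ^ m) [ m ]₄ (m^n>0 2 m) (trans (3*[k]₄+1≡4^k m) (4^≡2^*2^ m))

proposition2p22 : (n : ℕ) → 3 ≤ n →
    ((k : ℕ) → n ≡ 2 * k + 1 → NumParitySequences n (qInt 4 k))
    × ((m : ℕ) → n ≡ 2 * m → NumParitySequences n (qBinom2 2 m + 2 ^ (m ∸ 1) ∸ 1))
proposition2p22 n 3≤n = odd-case , even-case
  where
  numParitySequences-at : ∀ {n′} N → n ≡ n′ → count n′ isParityWord? ≡ N → NumParitySequences n N
  numParitySequences-at N refl count≡N = subst (NumParitySequences n) count≡N (numParitySequences-count n 3≤n)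

  odd-case : (k : ℕ) → n ≡ 2 * k + 1 → NumParitySequences n (qInt 4 k)
  odd-case k n≡2k+1 = numParitySequences-at _ (trans n≡2k+1 (2k+1≡1+k+k k)) (trans (#parityWords-odd k) (sym (qInt-4 k)))
    where
    2k+1≡1+k+k : ∀ k → 2 * k + 1 ≡ suc (k + k)
    2k+1≡1+k+k = solve-∀

  even-case : (m : ℕ) → n ≡ 2 * m → NumParitySequences n (qBinom2 2 m + 2 ^ (m ∸ 1) ∸ 1)
  even-case zero    refl = ⊥-elim (<⇒≱ 3≤n z≤n)
  even-case (suc m) n≡2m = numParitySequences-at _ (trans n≡2m (2[1+m]≡2+m+m m)) (trans (#parityWords-even m) (sym (qBinom2-2 m)))
    where
    2[1+m]≡2+m+m : ∀ m → 2 * suc m ≡ suc (suc (m + m))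
    2[1+m]≡2+m+m = solve-∀
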